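{- If $\mathcal{U}$ is a rapid p-point on $\omega$, then $\prod_{n<\omega}\mathcal{U}\equiv_T\mathcal{U}\cdot\mathcal{U}\equiv_T\mathcal{U}$.
   Context: An ultrafilter $\mathcal{U}$ on $\omega$ is rapid if for every $f:\omega\to\omega$ there is $X\in\mathcal{U}$ with $|X\cap f(n)|\le n$ for all $n$ (where $f(n)=\{0,\dots,f(n)-1\}$). A p-point is a nonprincipal ultrafilter on $\omega$ in which every countable subfamily $\{X_n\}$ has some $X$ in the ultrafilter with $X\setminus X_n$ finite for all $n$. Ultrafilters are ordered by $\supseteq$, $\prod_{n<\omega}\mathcal{U}$ by the coordinatewise order. $D\le_T E$ means there is a map $E\to D$ sending cofinal subsets to cofinal subsets; $\equiv_T$ means both directions. $\mathcal{U}\cdot\mathcal{U}=\{A\subseteq\omega\times\omega:\{i:\{j:(i,j)\in A\}\in\mathcal{U}\}\in\mathcal{U}\}$. -}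

module Defs where

open import Data.Nat using (ℕ; zero; suc; _≤_; _<_)
open import Data.Bool using (Bool; true; false; not)
open import Data.Product using (Σ; _×_; ∃; _,_)
open import Data.Empty using (⊥)
import Data.Sum
import Data.Bool
import Data.Nat
open import Relation.Nullary using (¬_)
open import Relation.Binary.PropositionalEquality using (_≡_)

Subset : Set
Subset = ℕ → Bool

_∈_ : ℕ → Subset → Set
n ∈ A = A n ≡ true

_⊆_ : Subset → Subset → Set
A ⊆ B = ∀ n → n ∈ A → n ∈ B

_∩_ : Subset → Subset → Subset
(A ∩ B) n = Data.Bool._∧_ (A n) (B n)

ω : Subset
ω _ = true

∅ : Subset
∅ _ = false

complement : Subset → Subset
complement A n = not (A n)

singleton : ℕ → Subset
singleton m n = Data.Nat._≡ᵇ_ m n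

Finite : Subset → Set
Finite X = ∃ λ N → ∀ m → N ≤ m → ¬ (m ∈ X)

AlmostSubset : Subset → Subset → Set
AlmostSubset X Y = ∃ λ N → ∀ m → N ≤ m → m ∈ X → m ∈ Y

count : Subset → ℕ → ℕ
count X zero = zero
count X (suc k) with X k
... | true  = suc (count X k)
... | false = count X k

Family : Set₁
Family = Subset → Set

record IsUltrafilter (U : Family) : Set where
  field
    has-ω     : U ω
    proper    : ¬ U ∅
    upward    : ∀ {A B} → A ⊆ B → U A → U B
    inter     : ∀ {A B} → U A → U B → U (A ∩ B)
    ultra     : ∀ A → U A Data.Sum.⊎ U (complement A)

NonPrincipal : Family → Set
NonPrincipal U = ∀ n → ¬ U (singleton n)

IsRapid : Family → Set
IsRapid U = (f : ℕ → ℕ) → Σ Subset λ X → U X × (∀ n → count X (f n) ≤ n)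

IsPPoint : Family → Set
IsPPoint U = IsUltrafilter U × NonPrincipal U ×
  ((Xs : ℕ → Subset) → (∀ n → U (Xs n)) →
     Σ Subset λ X → U X × (∀ n → AlmostSubset X (Xs n)))

record PreSet : Set₁ where
  field
    Carrier : Set
    _≼_     : Carrier → Carrier → Set

open PreSet

Cofinal : (D : PreSet) → (Carrier D → Set) → Set
Cofinal D C = ∀ d → ∃ λ c → C c × _≼_ D d c

ImageCofinal : (D E : PreSet) → (Carrier E → Carrier D) → (Carrier E → Set) → Set
ImageCofinal D E φ C = ∀ d → ∃ λ e → C e × _≼_ D d (φ e)

_≤T_ : PreSet → PreSet → Set₁
D ≤T E = Σ (Carrier E → Carrier D) λ φ →
           (C : Carrier E → Set) → Cofinal E C → ImageCofinal D E φ C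

_≡T_ : PreSet → PreSet → Set₁
D ≡T E = (D ≤T E) × (E ≤T D)

UltraPoset : Family → PreSet
UltraPoset U = record
  { Carrier = Σ Subset U
  ; _≼_ = λ { (A , _) (B , _) → B ⊆ A } }

ProdPoset : Family → PreSet
ProdPoset U = record
  { Carrier = ℕ → Σ Subset U
  ; _≼_ = λ a b → ∀ n → _≼_ (UltraPoset U) (a n) (b n) }

Subset² : Set
Subset² = ℕ → ℕ → Bool

_⊆²_ : Subset² → Subset² → Set
A ⊆² B = ∀ i j → A i j ≡ true → B i j ≡ true

-- A ∈ U·U  iff  {i : {j : (i,j) ∈ A} ∈ U} ∈ U.  Since U is upward closed,
-- this is: some X ∈ U is contained in {i : A_i ∈ U}.
_·_ : Family → Family → (Subset² → Set)
(U · V) A = Σ Subset λ X → U X × (∀ i → i ∈ X → V (A i))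

SquarePoset : Family → PreSet
SquarePoset U = record
  { Carrier = Σ Subset² (U · U)
  ; _≼_ = λ { (A , _) (B , _) → B ⊆² A } }

-- The three directed sets are compared by a cycle of Tukey reductions
--     ∏ U  ≤_T  U  ≤_T  U·U  ≤_T  ∏ U,
-- each given by a monotone map with cofinal image (a convergent map).
--   * U·U ≤_T ∏ U : a sequence (Y_n) codes the set ⋃_{i ∈ Y_0} {i} × Y_{i+1};
--     this works for any filter.
--   * U ≤_T U·U : a set A ∈ U·U is sent to {i : A_i ∈ U}; deciding the
--     membership A_i ∈ U is where excluded middle is used.
--   * ∏ U ≤_T U : a set X is sent to the sequence of its tails (X minus its
--     first n+1 elements), which lie in U because U is nonprincipal.  The image
--     is cofinal: given (Y_n), the p-point property yields Z almost contained in
--     every Y_n, say beyond N_n, and rapidity yields W with at most n elements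
--     below N_n; the n-th tail of Z ∩ W then lies beyond N_n, hence inside Y_n.
module Submission where

open import Defs
open import Data.Product using (_×_)
open import Level using (0ℓ)
open import Axiom.ExcludedMiddle using (ExcludedMiddle)

open import Data.Product using (Σ; _,_; proj₁; proj₂)
open import Data.Nat using (ℕ; zero; suc; _≤_; _<_; z≤n; s≤s; s≤s⁻¹; _≡ᵇ_; _<ᵇ_)
open import Data.Nat.Properties
open import Data.Bool using (Bool; true; false; T)
open import Data.Bool.Properties using (T-≡)
open import Data.Sum using (inj₁; inj₂)
open import Data.Empty using (⊥; ⊥-elim)
open import Function.Bundles using (Equivalence)
open import Relation.Nullary using (¬_; isYes)
open import Relation.Nullary.Decidable using (toWitness; fromWitness)
open import Relation.Binary using (tri<; tri≈; tri>)
open import Relation.Binary.Core using (_Preserves_⟶_)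
open import Relation.Binary.Definitions using (Transitive)
open import Relation.Binary.PropositionalEquality using (_≡_; refl; sym; trans)
open PreSet

-- Membership in Defs is 'b ≡ true'; the library's boolean tests speak of 'T b'.
T⇒true : ∀ {b} → T b → b ≡ true
T⇒true = Equivalence.to T-≡

true⇒T : ∀ {b} → b ≡ true → T b
true⇒T = Equivalence.from T-≡

∩-elimˡ : ∀ A B {m} → m ∈ (A ∩ B) → m ∈ A
∩-elimˡ A B {m} h with A m
... | true  = refl
... | false = h

∩-elimʳ : ∀ A B {m} → m ∈ (A ∩ B) → m ∈ B
∩-elimʳ A B {m} h with A m
... | true  = h
... | false with h
... | ()

∩-intro : ∀ A B {m} → m ∈ A → m ∈ B → m ∈ (A ∩ B)
∩-intro A B {m} a b with A m
... | true  = b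
... | false = a

∉-complement : ∀ A {m} → m ∈ complement A → ¬ (m ∈ A)
∉-complement A {m} h a with A m
... | true with h
... | ()
∉-complement A {m} h () | false

count-suc-∈ : ∀ A {k} → k ∈ A → count A (suc k) ≡ suc (count A k)
count-suc-∈ A {k} h with A k
... | true = refl
count-suc-∈ A {k} () | false

count-suc : ∀ A k → count A k ≤ count A (suc k)
count-suc A k with A k
... | true  = n≤1+n _
... | false = ≤-refl

count-mono : ∀ A {m n} → m ≤ n → count A m ≤ count A n
count-mono A {n = zero} z≤n = ≤-refl
count-mono A {n = suc n} m≤1+n with m≤n⇒m<n∨m≡n m≤1+n
... | inj₁ m<1+n = ≤-trans (count-mono A (s≤s⁻¹ m<1+n)) (count-suc A n)
... | inj₂ refl  = ≤-refl

count-⊆ : ∀ {A B} → A ⊆ B → ∀ k → count A k ≤ count B k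
count-⊆ {A} {B} A⊆B zero = z≤n
count-⊆ {A} {B} A⊆B (suc k) with A k in k∈A? | B k in k∈B?
... | true  | true  = s≤s (count-⊆ A⊆B k)
... | false | true  = m≤n⇒m≤1+n (count-⊆ A⊆B k)
... | false | false = count-⊆ A⊆B k
... | true  | false with trans (sym k∈B?) (A⊆B k k∈A?)
... | ()

count-strict : ∀ A {m n} → m ∈ A → m < n → count A m < count A n
count-strict A {m} {n} m∈A m<n = begin-strict
  count A m        <⟨ n<1+n _ ⟩
  suc (count A m)  ≡⟨ sym (count-suc-∈ A m∈A) ⟩
  count A (suc m)  ≤⟨ count-mono A m<n ⟩
  count A n        ∎
  where open ≤-Reasoning

count-injective : ∀ A {m m'} → m ∈ A → m' ∈ A → count A m ≡ count A m' → m ≡ m'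
count-injective A {m} {m'} m∈A m'∈A eq with <-cmp m m'
... | tri≈ _ m≡m' _ = m≡m'
... | tri< m<m' _ _ = ⊥-elim (<⇒≢ (count-strict A m∈A m<m') eq)
... | tri> _ _ m'<m = ⊥-elim (<⇒≢ (count-strict A m'∈A m'<m) (sym eq))

atPosition : Subset → ℕ → Subset
atPosition A k m = count A m ≡ᵇ k

beyond : Subset → ℕ → Subset
beyond A n m = n <ᵇ count A m

level : Subset → ℕ → Subset
level A k = A ∩ atPosition A k

level-subsingleton : ∀ A k {m m'} → m ∈ level A k → m' ∈ level A k → m ≡ m'
level-subsingleton A k {m} {m'} h h' =
  count-injective A (∩-elimˡ A (atPosition A k) h) (∩-elimˡ A (atPosition A k) h')
    (trans (position h) (sym (position h')))
  where
  position : ∀ {n} → n ∈ level A k → count A n ≡ k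
  position {n} h'' = ≡ᵇ⇒≡ _ _ (true⇒T (∩-elimʳ A (atPosition A k) h''))

-- The tail of A after its first n+1 members.
tail : Subset → ℕ → Subset
tail A n = A ∩ beyond A n

tail-⊆ : ∀ A n {m} → m ∈ tail A n → m ∈ A
tail-⊆ A n = ∩-elimˡ A (beyond A n)

tail-position : ∀ A n {m} → m ∈ tail A n → n < count A m
tail-position A n h = <ᵇ⇒< _ _ (true⇒T (∩-elimʳ A (beyond A n) h))

tail-mono : ∀ {A B} → A ⊆ B → ∀ n → tail A n ⊆ tail B n
tail-mono {A} {B} A⊆B n m h =
  ∩-intro B (beyond B n) (A⊆B m (tail-⊆ A n h))
    (T⇒true (<⇒<ᵇ (<-≤-trans (tail-position A n h) (count-⊆ A⊆B m))))

monotone-cofinal⇒≤T : (D E : PreSet) → Transitive (_≼_ D) →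
  (φ : Carrier E → Carrier D) → φ Preserves _≼_ E ⟶ _≼_ D →
  (∀ d → Σ (Carrier E) λ e → _≼_ D d (φ e)) → D ≤T E
monotone-cofinal⇒≤T D E trans φ mono cof = φ , image-cofinal
  where
  image-cofinal : (C : Carrier E → Set) → Cofinal E C → ImageCofinal D E φ C
  image-cofinal C C-cofinal d with cof d
  ... | e , d≼φe with C-cofinal e
  ... | c , c∈C , e≼c = c , c∈C , trans d≼φe (mono e≼c)

≤T-trans : (D E F : PreSet) → D ≤T E → E ≤T F → D ≤T F
≤T-trans D E F (φ , φ-tukey) (ψ , ψ-tukey) = (λ f → φ (ψ f)) , composite
  where
  composite : (C : Carrier F → Set) → Cofinal F C → ImageCofinal D F (λ f → φ (ψ f)) C
  composite C C-cofinal d with φ-tukey ψ[C] ψ[C]-cofinal d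
    where
    ψ[C] : Carrier E → Set
    ψ[C] e = Σ (Carrier F) λ c → C c × e ≡ ψ c
    ψ[C]-cofinal : Cofinal E ψ[C]
    ψ[C]-cofinal e with ψ-tukey C C-cofinal e
    ... | c , c∈C , e≼ψc = ψ c , (c , c∈C , refl) , e≼ψc
  ... | ._ , (c , c∈C , refl) , d≼φψc = c , c∈C , d≼φψc

module Ultrafilter (U : Family) (uf : IsUltrafilter U) where
  open IsUltrafilter uf

  ultra-trans : Transitive (_≼_ (UltraPoset U))
  ultra-trans ab bc m h = ab m (bc m h)

  prod-trans : Transitive (_≼_ (ProdPoset U))
  prod-trans ab bc n m h = ab n m (bc n m h)

  square-trans : Transitive (_≼_ (SquarePoset U))
  square-trans ab bc i j h = ab i j (bc i j h)

  constant∈U : ∀ b → U (λ _ → b) → b ≡ true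
  constant∈U true  _ = refl
  constant∈U false u = ⊥-elim (proper u)

  -- The set B when b holds, and ω otherwise; used to pad a partial family.
  guarded : (b : Bool) (B : Subset) → (b ≡ true → U B) → Σ Subset U
  guarded true  B B∈U = B , B∈U refl
  guarded false B _   = ω , has-ω

  guarded-⊆ : ∀ b B B∈U → b ≡ true → proj₁ (guarded b B B∈U) ⊆ B
  guarded-⊆ true B B∈U _ m h = h

  square≤product : SquarePoset U ≤T ProdPoset U
  square≤product = monotone-cofinal⇒≤T (SquarePoset U) (ProdPoset U)
                     (λ {a} {b} {c} → square-trans {a} {b} {c}) code
                     (λ {Y} {Y'} → code-mono {Y} {Y'}) code-cofinal
    where
    row : Carrier (ProdPoset U) → ℕ → Subset
    row Y i = (λ _ → proj₁ (Y 0) i) ∩ proj₁ (Y (suc i))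

    code : Carrier (ProdPoset U) → Carrier (SquarePoset U)
    code Y = row Y , proj₁ (Y 0) , proj₂ (Y 0) ,
             λ i i∈Y₀ → upward (λ j → ∩-intro (λ _ → proj₁ (Y 0) i) (proj₁ (Y (suc i))) i∈Y₀)
                               (proj₂ (Y (suc i)))

    code-mono : code Preserves _≼_ (ProdPoset U) ⟶ _≼_ (SquarePoset U)
    code-mono {Y} {Y'} Y'⊆Y i j h =
      ∩-intro (λ _ → proj₁ (Y 0) i) (proj₁ (Y (suc i)))
        (Y'⊆Y 0 i (∩-elimˡ (λ _ → proj₁ (Y' 0) i) (proj₁ (Y' (suc i))) h))
        (Y'⊆Y (suc i) j (∩-elimʳ (λ _ → proj₁ (Y' 0) i) (proj₁ (Y' (suc i))) h))

    code-cofinal : ∀ A → Σ (Carrier (ProdPoset U)) λ Y → _≼_ (SquarePoset U) A (code Y)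
    code-cofinal (A , X , X∈U , A-sections) = Y , codeY⊆A
      where
      Y : ℕ → Σ Subset U
      Y zero    = X , X∈U
      Y (suc i) = guarded (X i) (A i) (A-sections i)
      codeY⊆A : proj₁ (code Y) ⊆² A
      codeY⊆A i j h = guarded-⊆ (X i) (A i) (A-sections i)
                        (∩-elimˡ (λ _ → X i) (proj₁ (Y (suc i))) h) j
                        (∩-elimʳ (λ _ → X i) (proj₁ (Y (suc i))) h)

  ultra≤square : ExcludedMiddle 0ℓ → UltraPoset U ≤T SquarePoset U
  ultra≤square em = monotone-cofinal⇒≤T (UltraPoset U) (SquarePoset U)
                      (λ {a} {b} {c} → ultra-trans {a} {b} {c}) large
                      (λ {A} {B} → large-mono {A} {B}) large-cofinal
    where
    largeSections : Subset² → Subset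
    largeSections A i = isYes (em {U (A i)})

    large : Carrier (SquarePoset U) → Carrier (UltraPoset U)
    large (A , X , X∈U , A-sections) =
      largeSections A , upward (λ i i∈X → T⇒true (fromWitness (A-sections i i∈X))) X∈U

    large-mono : large Preserves _≼_ (SquarePoset U) ⟶ _≼_ (UltraPoset U)
    large-mono {A , _} {B , _} B⊆A i h =
      T⇒true (fromWitness (upward (B⊆A i) (toWitness (true⇒T h))))

    -- Y is recovered from the product Y × ω.
    large-cofinal : ∀ Y → Σ (Carrier (SquarePoset U)) λ A → _≼_ (UltraPoset U) Y (large A)
    large-cofinal (Y , Y∈U) =
      ((λ i _ → Y i) , Y , Y∈U , λ i i∈Y → upward (λ _ _ → i∈Y) has-ω) ,
      λ i h → constant∈U (Y i) (toWitness (true⇒T h))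

module NonPrincipalUltrafilter (U : Family) (uf : IsUltrafilter U) (np : NonPrincipal U) where
  open IsUltrafilter uf

  subsingleton∉ : ∀ S → (∀ {m m'} → m ∈ S → m' ∈ S → m ≡ m') → ¬ U S
  subsingleton∉ S unique S∈U = proper (upward empty S∈U)
    where
    empty : S ⊆ ∅
    empty m m∈S = ⊥-elim (np m (upward (λ m' m'∈S → T⇒true (≡⇒≡ᵇ m m' (unique m∈S m'∈S))) S∈U))

  -- A set with at most k elements is not in U; removing the element at
  -- position k−1 (its level set is not in U) reduces k by one.
  bounded∉ : ∀ k A → (∀ {m} → m ∈ A → count A m < k) → ¬ U A
  bounded∉ zero A bound A∈U = proper (upward (λ m m∈A → ⊥-elim (n≮0 (bound m∈A))) A∈U)
  bounded∉ (suc k) A bound A∈U with ultra (level A k)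
  ... | inj₁ top∈U  = subsingleton∉ (level A k) (level-subsingleton A k) top∈U
  ... | inj₂ rest∈U = bounded∉ k rest rest-bound (inter A∈U rest∈U)
    where
    rest : Subset
    rest = A ∩ complement (level A k)
    rest⊆A : rest ⊆ A
    rest⊆A m = ∩-elimˡ A (complement (level A k))
    rest-bound : ∀ {m} → m ∈ rest → count rest m < k
    rest-bound {m} m∈rest = ≤-<-trans (count-⊆ rest⊆A m)
      (≤∧≢⇒< (s≤s⁻¹ (bound (rest⊆A m m∈rest))) not-top)
      where
      not-top : count A m ≡ k → ⊥
      not-top eq = ∉-complement (level A k) (∩-elimʳ A (complement (level A k)) m∈rest)
                     (∩-intro A (atPosition A k) (rest⊆A m m∈rest) (T⇒true (≡⇒≡ᵇ _ _ eq)))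

  tail∈U : ∀ X n → U X → U (tail X n)
  tail∈U X n X∈U with ultra (beyond X n)
  ... | inj₁ late∈U  = inter X∈U late∈U
  ... | inj₂ early∈U = ⊥-elim (bounded∉ (suc n) head head-bound (inter X∈U early∈U))
    where
    head : Subset
    head = X ∩ complement (beyond X n)
    head-bound : ∀ {m} → m ∈ head → count head m < suc n
    head-bound {m} m∈head = s≤s (≤-trans (count-⊆ head⊆X m) (≮⇒≥ early))
      where
      head⊆X : head ⊆ X
      head⊆X k = ∩-elimˡ X (complement (beyond X n))
      early : ¬ (n < count X m)
      early n<count = ∉-complement (beyond X n) {m} (∩-elimʳ X (complement (beyond X n)) m∈head)
                        (T⇒true (<⇒<ᵇ n<count))

product≤ultra : (U : Family) → IsPPoint U → IsRapid U → ProdPoset U ≤T UltraPoset U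
product≤ultra U (uf , np , diagonalise) rapid =
  monotone-cofinal⇒≤T (ProdPoset U) (UltraPoset U) (λ {a} {b} {c} → prod-trans {a} {b} {c})
    tails (λ {X} {X'} → tails-mono {X} {X'}) tails-cofinal
  where
  open IsUltrafilter uf
  open Ultrafilter U uf using (prod-trans)
  open NonPrincipalUltrafilter U uf np using (tail∈U)

  tails : Carrier (UltraPoset U) → Carrier (ProdPoset U)
  tails (X , X∈U) n = tail X n , tail∈U X n X∈U

  tails-mono : tails Preserves _≼_ (UltraPoset U) ⟶ _≼_ (ProdPoset U)
  tails-mono X'⊆X = tail-mono X'⊆X

  tails-cofinal : ∀ Y → Σ (Carrier (UltraPoset U)) λ X → _≼_ (ProdPoset U) Y (tails X)
  tails-cofinal Y with diagonalise (λ n → proj₁ (Y n)) (λ n → proj₂ (Y n))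
  ... | Z , Z∈U , Z⊆*Y with rapid (λ n → proj₁ (Z⊆*Y n))
  ... | W , W∈U , W-sparse = (Z ∩ W , inter Z∈U W∈U) , tail⊆Y
    where
    -- Z ∖ Y_n lies below N n, and Z ∩ W has at most n elements below N n.
    N : ℕ → ℕ
    N n = proj₁ (Z⊆*Y n)
    tail⊆Y : ∀ n → tail (Z ∩ W) n ⊆ proj₁ (Y n)
    tail⊆Y n m h = proj₂ (Z⊆*Y n) m past-N (∩-elimˡ Z W (tail-⊆ (Z ∩ W) n h))
      where
      past-N : N n ≤ m
      past-N = ≮⇒≥ λ m<N → <⇒≱ (tail-position (Z ∩ W) n h) (begin
        count (Z ∩ W) m      ≤⟨ count-mono (Z ∩ W) (<⇒≤ m<N) ⟩
        count (Z ∩ W) (N n)  ≤⟨ count-⊆ (λ k → ∩-elimʳ Z W {k}) (N n) ⟩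
        count W (N n)        ≤⟨ W-sparse n ⟩
        n                    ∎)
        where open ≤-Reasoning

corollary37 : ExcludedMiddle 0ℓ → (U : Family) → IsPPoint U → IsRapid U →
    (ProdPoset U ≡T SquarePoset U) × (SquarePoset U ≡T UltraPoset U)
corollary37 em U pp rapid =
  (≤T-trans P V S P≤V V≤S , S≤P) , (≤T-trans S P V S≤P P≤V , V≤S)
  where
  open Ultrafilter U (proj₁ pp) using (square≤product; ultra≤square)
  P S V : PreSet
  P = ProdPoset U
  S = SquarePoset U
  V = UltraPoset U
  P≤V : P ≤T V
  P≤V = product≤ultra U pp rapid
  V≤S : V ≤T S
  V≤S = ultra≤square em
  S≤P : S ≤T P
  S≤P = square≤product
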